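{- Let $N$ be a natural number and $A\subseteq{}^N2$. If there is $\sigma\in{}^{\underline N}2$ such that $\Delta(A)\preceq\{\sigma\}$, then $P^+(A)$ cannot be split by fewer than $|\sigma|-1$ sets, i.e. for every $m<|\sigma|-1$ there is no partition of $N$ into $m$ sets splitting $P^+(A)$.
   Context: $N$ is identified with $\{0,\ldots,N-1\}$. ${}^N2$ is the set of all functions $f:N\to\{0,1\}$; ${}^{\underline N}2$ is the set of all partial functions $\sigma$ with $\mathrm{dom}(\sigma)\subseteq N$ and values in $\{0,1\}$ (including the empty function); functions are sets of ordered pairs, so $|\sigma|=|\mathrm{dom}(\sigma)|$. For $\sigma\in{}^{\underline N}2$, $[\sigma]=\{f\in{}^N2:\sigma\subseteq f\}$. For $A\subseteq{}^N2$, $\Delta(A)=\{\sigma\in{}^{\underline N}2:[\sigma]\cap A=\emptyset\text{ and }[\rho]\cap A\neq\emptyset\text{ for all }\rho\subsetneq\sigma\}$. For $\delta_1,\delta_2\subseteq{}^{\underline N}2$, $\delta_1\preceq\delta_2$ iff every $\sigma\in\delta_1$ has some $\rho\in\delta_2$ with $\rho\subseteq\sigma$. For $\sigma\in{}^{\underline N}2$, $P(\sigma)=\{a\in\mathrm{dom}(\sigma):\sigma(a)=1\}$, and $P^+(A)=\{P(f):f\in A,\ |P(f)|\geq2\}$. For a family $\mathcal B$ of subsets of $N$ and a partition $V_0,\ldots,V_{m-1}$ of $N$ (pairwise disjoint, possibly empty, union $N$), $\mathcal B$ is split by $V_0,\ldots,V_{m-1}$ if no element of $\mathcal B$ is contained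 in any single $V_k$; $\mathcal B$ can be split by $m$ sets if some partition of $N$ into $m$ sets splits it. -}

module Defs where

open import Data.Nat using (ℕ; zero; suc; _+_; _≤_)
open import Data.Fin using (Fin; zero; suc)
open import Data.Bool using (Bool; true; false)
open import Data.Maybe using (Maybe; just; nothing)
open import Data.Product using (Σ; ∃; _×_)
open import Relation.Binary.PropositionalEquality using (_≡_)
open import Relation.Nullary using (¬_)

Total : ℕ → Set
Total N = Fin N → Bool

-- Partial functions N ⇀ 2 (domain = positions mapped to 'just').
Partial : ℕ → Set
Partial N = Fin N → Maybe Bool

-- A subset of ^N 2, given by its (decidable, since ^N 2 is finite) characteristic function.
Family : ℕ → Set
Family N = Total N → Bool

_∈A_ : ∀ {N} → Total N → Family N → Set
f ∈A A = A f ≡ true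

countT : ∀ {N} → (Fin N → Bool) → ℕ
countT {zero} g = 0
countT {suc N} g with g zero
... | true  = suc (countT (λ i → g (suc i)))
... | false = countT (λ i → g (suc i))

isDef : Maybe Bool → Bool
isDef (just _) = true
isDef nothing  = false

size : ∀ {N} → Partial N → ℕ
size σ = countT (λ i → isDef (σ i))

-- σ ⊆ f (as sets of ordered pairs), i.e. f ∈ [σ]
_⊑_ : ∀ {N} → Partial N → Total N → Set
σ ⊑ f = ∀ i b → σ i ≡ just b → f i ≡ b

_⊆ₚ_ : ∀ {N} → Partial N → Partial N → Set
ρ ⊆ₚ σ = ∀ i b → ρ i ≡ just b → σ i ≡ just b

_⊊ₚ_ : ∀ {N} → Partial N → Partial N → Set
ρ ⊊ₚ σ = ρ ⊆ₚ σ × ¬ (∀ i → ρ i ≡ σ i)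

Disjoint : ∀ {N} → Partial N → Family N → Set
Disjoint σ A = ∀ f → σ ⊑ f → ¬ (f ∈A A)

Meets : ∀ {N} → Partial N → Family N → Set
Meets σ A = ¬ Disjoint σ A

InΔ : ∀ {N} → Family N → Partial N → Set
InΔ A σ = Disjoint σ A × (∀ ρ → ρ ⊊ₚ σ → Meets ρ A)

ΔPrecSingleton : ∀ {N} → Family N → Partial N → Set
ΔPrecSingleton A σ = ∀ τ → InΔ A τ → σ ⊆ₚ τ

-- P^+(A) is split by the partition given by V : N → Fin m (V_k = V⁻¹(k)):
-- no P(f) with f ∈ A and |P(f)| ≥ 2 is contained in a single V_k.
SplitsP⁺ : ∀ {N m} → Family N → (Fin N → Fin m) → Set
SplitsP⁺ {N} {m} A V =
  ∀ f → f ∈A A → 2 ≤ countT f →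
  ¬ (Σ (Fin m) λ k → ∀ i → f i ≡ true → V i ≡ k)

-- If x ≠ y lie in the same block,
-- the only function extending the total function 1_{x,y} is 1_{x,y} itself, whose positive
-- part {x, y} is not split, so it lies outside A: the cylinder of 1_{x,y} is disjoint from A.
-- Shrinking a disjoint cylinder while it stays disjoint ends in an element of Δ(A), which
-- contains σ; hence σ ⊆ 1_{x,y}. With at least m + 2 points in dom σ, pigeonhole yields a
-- same-block pair {a, b} ⊆ dom σ and another one {c, d} ⊆ dom σ avoiding a, which force
-- σ(a) = 1 and σ(a) = 0 respectively.
module Submission where

open import Defs
open import Data.Nat using (ℕ; _+_; _<_; _∸_; zero; suc; _≤_; z≤n; s≤s)
open import Data.Nat.Properties using (≤-trans; n≤1+n; n<1+n)
open import Data.Nat.Induction using (<-wellFounded)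
open import Data.Fin using (Fin; zero; suc; inject≤; punchIn; _≟_)
open import Data.Fin.Properties
  using (suc-injective; ¬∀⟶∃¬; pigeonhole; <⇒≢; inject≤-injective; punchIn-injective; punchInᵢ≢i)
open import Data.Bool using (Bool; true; false; _∨_)
open import Data.Bool.Properties using (∨-zeroʳ) renaming (_≟_ to _≟ᵇ_)
open import Data.Maybe using (just; nothing)
open import Data.Maybe.Properties using (≡-dec; just-injective)
open import Data.Empty using (⊥)
open import Data.Product using (Σ; _,_; proj₁)
open import Data.Sum using (_⊎_; inj₁; inj₂)
open import Function using (_∘_; _on_)
open import Function.Definitions using (Injective)
open import Induction.WellFounded using (Acc; acc)
open import Relation.Binary.Construct.On using () renaming (wellFounded to wellFounded-on)
open import Relation.Nullary using (¬_; does; yes; no; contradiction)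
open import Relation.Nullary.Decidable using (dec-true; dec-false; decidable-stable)
open import Relation.Binary.PropositionalEquality using (_≡_; _≢_; refl; sym; trans; cong; module ≡-Reasoning)

private variable N : ℕ

countT-mono : {g h : Fin N → Bool} → (∀ i → g i ≡ true → h i ≡ true) → countT g ≤ countT h
countT-mono {zero} g⊆h = z≤n
countT-mono {suc N} {g} {h} g⊆h with g zero in g₀ | h zero in h₀
... | true  | true  = s≤s (countT-mono (g⊆h ∘ suc))
... | true  | false with () ← trans (sym (g⊆h zero g₀)) h₀
... | false | true  = ≤-trans (countT-mono (g⊆h ∘ suc)) (n≤1+n _)
... | false | false = countT-mono (g⊆h ∘ suc)

countT-< : {g h : Fin N → Bool} → (∀ i → g i ≡ true → h i ≡ true) →
           ∀ x → g x ≡ false → h x ≡ true → countT g < countT h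
countT-< {suc N} {g} {h} g⊆h x gx hx with g zero in g₀ | h zero in h₀ | x
... | true  | false | _     with () ← trans (sym (g⊆h zero g₀)) h₀
... | false | true  | zero  = s≤s (countT-mono (g⊆h ∘ suc))
... | true  | true  | zero  with () ← trans (sym g₀) gx
... | false | false | zero  with () ← trans (sym h₀) hx
... | true  | true  | suc x = s≤s (countT-< (g⊆h ∘ suc) x gx hx)
... | false | true  | suc x = ≤-trans (countT-< (g⊆h ∘ suc) x gx hx) (n≤1+n _)
... | false | false | suc x = countT-< (g⊆h ∘ suc) x gx hx

enumerate : (g : Fin N → Bool) → Fin (countT g) → Fin N
enumerate {suc N} g k with g zero
... | true  with k
...   | zero   = zero
...   | suc k′ = suc (enumerate (g ∘ suc) k′)
enumerate {suc N} g k | false = suc (enumerate (g ∘ suc) k)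

enumerate-true : (g : Fin N → Bool) (k : Fin (countT g)) → g (enumerate g k) ≡ true
enumerate-true {suc N} g k with g zero in g₀
... | true  with k
...   | zero   = g₀
...   | suc k′ = enumerate-true (g ∘ suc) k′
enumerate-true {suc N} g k | false = enumerate-true (g ∘ suc) k

enumerate-injective : (g : Fin N → Bool) → Injective _≡_ _≡_ (enumerate g)
enumerate-injective {suc N} g {k} {l} eq with g zero | k | l
... | true  | zero   | zero   = refl
... | true  | suc k′ | suc l′ = cong suc (enumerate-injective (g ∘ suc) (suc-injective eq))
... | true  | zero   | suc _  with () ← eq
... | true  | suc _  | zero   with () ← eq
... | false | k′     | l′     = enumerate-injective (g ∘ suc) (suc-injective eq)

Pair : Fin N → Fin N → Total N
Pair x y k = does (k ≟ x) ∨ does (k ≟ y)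

Pair-left : ∀ (x y : Fin N) → Pair x y x ≡ true
Pair-left x y rewrite dec-true (x ≟ x) refl = refl

Pair-right : ∀ (x y : Fin N) → Pair x y y ≡ true
Pair-right x y rewrite dec-true (y ≟ y) refl = ∨-zeroʳ _

Pair-outside : ∀ {x y k : Fin N} → k ≢ x → k ≢ y → Pair x y k ≡ false
Pair-outside {x = x} {y} {k} k≢x k≢y rewrite dec-false (k ≟ x) k≢x | dec-false (k ≟ y) k≢y = refl

Pair-true : ∀ (x y k : Fin N) → Pair x y k ≡ true → k ≡ x ⊎ k ≡ y
Pair-true x y k eq with k ≟ x | k ≟ y
... | yes k≡x | _       = inj₁ k≡x
... | no _    | yes k≡y = inj₂ k≡y
Pair-true _ _ _ () | no _ | no _

2≤countT-Pair : ∀ {x y : Fin N} → x ≢ y → 2 ≤ countT (Pair x y)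
2≤countT-Pair {x = x} {y} x≢y =
  ≤-trans (s≤s (≤-trans (s≤s z≤n) (countT-< {h = Pair x x} (λ _ ()) x refl (Pair-left x x))))
          (countT-< x∈Pair y (Pair-outside (x≢y ∘ sym) (x≢y ∘ sym)) (Pair-right x y))
  where
  x∈Pair : ∀ k → Pair x x k ≡ true → Pair x y k ≡ true
  x∈Pair k p with Pair-true x x k p
  ... | inj₁ refl = Pair-left x y
  ... | inj₂ refl = Pair-left x y

size-< : {ρ τ : Partial N} → ρ ⊊ₚ τ → size ρ < size τ
size-< {ρ = ρ} {τ} (ρ⊆τ , ρ≢τ) with ¬∀⟶∃¬ _ _ (λ i → ≡-dec _≟ᵇ_ (ρ i) (τ i)) ρ≢τ
... | i , ρi≢τi with ρ i in ρi | τ i in τi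
...   | just b  | _       = contradiction (trans (sym (ρ⊆τ i b ρi)) τi) ρi≢τi
...   | nothing | nothing = contradiction refl ρi≢τi
...   | nothing | just _  = countT-< dom⊆ i (cong isDef ρi) (cong isDef τi)
  where
  dom⊆ : ∀ j → isDef (ρ j) ≡ true → isDef (τ j) ≡ true
  dom⊆ j p with ρ j in ρj
  ... | just b rewrite ρ⊆τ j b ρj = refl

⊆ₚ-trans : {ρ σ τ : Partial N} → ρ ⊆ₚ σ → σ ⊆ₚ τ → ρ ⊆ₚ τ
⊆ₚ-trans ρ⊆σ σ⊆τ i b = σ⊆τ i b ∘ ρ⊆σ i b

⊆ₚ-stable : {σ τ : Partial N} → ¬ ¬ (σ ⊆ₚ τ) → σ ⊆ₚ τ
⊆ₚ-stable {τ = τ} ¬¬σ⊆τ i b σi =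
  decidable-stable (≡-dec _≟ᵇ_ (τ i) (just b)) λ τi≢b → ¬¬σ⊆τ λ σ⊆τ → τi≢b (σ⊆τ i b σi)

⊆ₚ-total : {σ : Partial N} {f : Total N} → σ ⊆ₚ (just ∘ f) → ∀ i → isDef (σ i) ≡ true → σ i ≡ just (f i)
⊆ₚ-total {σ = σ} σ⊆f i σi-defined with σ i in σi
... | just b = sym (σ⊆f i b σi)

Pair-conflict : {σ : Partial N} {a b c d : Fin N} → σ ⊆ₚ (just ∘ Pair a b) → σ ⊆ₚ (just ∘ Pair c d) →
                isDef (σ a) ≡ true → a ≢ c → a ≢ d → ⊥
Pair-conflict {a = a} {b} {c} {d} σ⊆ab σ⊆cd σa-defined a≢c a≢d = contradiction true≡false λ ()
  where
  open ≡-Reasoning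
  true≡false : true ≡ false
  true≡false = begin
    true        ≡⟨ Pair-left a b ⟨
    Pair a b a  ≡⟨ just-injective (trans (sym (⊆ₚ-total σ⊆ab a σa-defined)) (⊆ₚ-total σ⊆cd a σa-defined)) ⟩
    Pair c d a  ≡⟨ Pair-outside a≢c a≢d ⟩
    false       ∎

module _ {N : ℕ} {A : Family N} {σ : Partial N} (Δ≼σ : ΔPrecSingleton A σ) where

  private
    -- Nothing decides whether a proper part of τ still meets A, so the descent to Δ(A)
    -- only yields a double negation; ⊆ₚ-stable removes it.
    ¬¬⊆-disjoint : ∀ τ → Acc (_<_ on size) τ → Disjoint τ A → ¬ ¬ (σ ⊆ₚ τ)
    ¬¬⊆-disjoint τ (acc smaller) τ-disjoint σ⊈τ = σ⊈τ (Δ≼σ τ (τ-disjoint , meets))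
      where
      meets : ∀ ρ → ρ ⊊ₚ τ → Meets ρ A
      meets ρ ρ⊊τ ρ-disjoint = ¬¬⊆-disjoint ρ (smaller (size-< ρ⊊τ)) ρ-disjoint
        λ σ⊆ρ → σ⊈τ (⊆ₚ-trans σ⊆ρ (proj₁ ρ⊊τ))

  ΔPrecSingleton⇒⊆-disjoint : ∀ {τ} → Disjoint τ A → σ ⊆ₚ τ
  ΔPrecSingleton⇒⊆-disjoint {τ} τ-disjoint =
    ⊆ₚ-stable (¬¬⊆-disjoint τ (wellFounded-on size <-wellFounded τ) τ-disjoint)

Pair-disjoint : ∀ {m} {A : Family N} {V : Fin N → Fin m} {x y} →
                SplitsP⁺ A V → x ≢ y → V x ≡ V y → Disjoint (just ∘ Pair x y) A
Pair-disjoint {V = V} {x} {y} splits x≢y Vx≡Vy f Pair⊑f f∈A =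
  splits f f∈A (≤-trans (2≤countT-Pair x≢y) (countT-mono Pair⊆f)) (V x , same-block)
  where
  f≡Pair : ∀ i → f i ≡ Pair x y i
  f≡Pair i = Pair⊑f i _ refl
  Pair⊆f : ∀ i → Pair x y i ≡ true → f i ≡ true
  Pair⊆f i = trans (f≡Pair i)
  same-block : ∀ i → f i ≡ true → V i ≡ V x
  same-block i fi with Pair-true x y i (trans (sym (f≡Pair i)) fi)
  ... | inj₁ refl = refl
  ... | inj₂ refl = sym Vx≡Vy

module _ {N m : ℕ} {σ : Partial N} (V : Fin N → Fin m) (2+m≤|σ| : 2 + m ≤ size σ) where

  private
    e : Fin (2 + m) → Fin N
    e k = enumerate (isDef ∘ σ) (inject≤ k 2+m≤|σ|)

    e-injective : Injective _≡_ _≡_ e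
    e-injective = inject≤-injective _ _ _ _ ∘ enumerate-injective (isDef ∘ σ)

    e-defined : ∀ k → isDef (σ (e k)) ≡ true
    e-defined k = enumerate-true (isDef ∘ σ) (inject≤ k 2+m≤|σ|)

  ¬⊆-all-same-block-Pairs : ¬ (∀ x y → x ≢ y → V x ≡ V y → σ ⊆ₚ (just ∘ Pair x y))
  ¬⊆-all-same-block-Pairs forced
    with i , j , i<j , Vi≡Vj ← pigeonhole (n<1+n m) (V ∘ e ∘ suc)
    with k , l , k<l , Vk≡Vl ← pigeonhole (n<1+n m) (V ∘ e ∘ punchIn (suc i))
    = Pair-conflict
        (forced _ _ (<⇒≢ i<j ∘ suc-injective ∘ e-injective) Vi≡Vj)
        (forced _ _ (<⇒≢ k<l ∘ punchIn-injective (suc i) k l ∘ e-injective) Vk≡Vl)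
        (e-defined (suc i))
        (punchInᵢ≢i (suc i) k ∘ sym ∘ e-injective)
        (punchInᵢ≢i (suc i) l ∘ sym ∘ e-injective)

mainTheorem20 : (N : ℕ) (A : Family N) (σ : Partial N) →
    ΔPrecSingleton A σ →
    ∀ m → m < size σ ∸ 1 →
      ¬ (Σ (Fin N → Fin m) λ V → SplitsP⁺ A V)
mainTheorem20 N A σ Δ≼σ m m<|σ|∸1 (V , splits) =
  ¬⊆-all-same-block-Pairs V (<∸1⇒2+≤ m<|σ|∸1) λ x y x≢y Vx≡Vy →
    ΔPrecSingleton⇒⊆-disjoint Δ≼σ (Pair-disjoint splits x≢y Vx≡Vy)
  where
  <∸1⇒2+≤ : ∀ {k n} → k < n ∸ 1 → 2 + k ≤ n
  <∸1⇒2+≤ {n = suc n} k<n = s≤s k<n
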